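{- For each even integer $n \ge 6$, there exist a simple binary matroid $M$ of rank $n-1$ with $2n$ elements and a colouring $c$ of $E(M)$ in which each colour class has size exactly $2$, such that every circuit of $M$ whose elements have pairwise distinct colours has size strictly greater than $n/2$.
   Context: A matroid is a finite ground set with a collection of nonempty, inclusion-incomparable subsets called circuits satisfying circuit elimination; its rank is the size of a largest subset containing no circuit. A matroid is simple if it has no circuits of size $1$ or $2$. A matroid is binary if it is isomorphic to the column matroid of a matrix over the two-element field $\mathbb{F}_2$, i.e. the matroid on the columns whose circuits are the inclusion-minimal linearly dependent sets of columns. -}

module Defs where

open import Data.Nat using (ℕ; _<_; _≤_; _*_)
open import Data.Nat.Divisibility using (_∣_)
open import Data.Bool using (Bool; true; false; _∧_; _xor_)
open import Data.Fin using (Fin)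
open import Data.Fin.Subset using (Subset; _∈_; _⊆_; _⊂_; ∣_∣; Nonempty)
open import Data.Vec using (lookup; tabulate; foldr′)
open import Data.Product using (Σ; _×_; ∃)
open import Relation.Binary.PropositionalEquality using (_≡_)
open import Relation.Nullary using (¬_)

-- A binary matrix with m rows, given by its N columns (each a vector in F₂^m).
Matrix₂ : ℕ → ℕ → Set
Matrix₂ m N = Fin N → Fin m → Bool

colSum : ∀ {m N} → Matrix₂ m N → Subset N → Fin m → Bool
colSum {N = N} A S i = foldr′ _xor_ false (tabulate λ e → lookup S e ∧ A e i)

-- Over F₂ a nontrivial linear combination of columns of S is the sum over a
-- nonempty subset T ⊆ S; S is linearly dependent iff some such sum is zero.
Dependent : ∀ {m N} → Matrix₂ m N → Subset N → Set
Dependent A S = ∃ λ T → T ⊆ S × Nonempty T × (∀ i → colSum A T i ≡ false)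

Circuit : ∀ {m N} → Matrix₂ m N → Subset N → Set
Circuit A C = Dependent A C × (∀ D → D ⊂ C → ¬ Dependent A D)

CircuitFree : ∀ {m N} → Matrix₂ m N → Subset N → Set
CircuitFree A S = ∀ C → Circuit A C → ¬ (C ⊆ S)

HasRank : ∀ {m N} → Matrix₂ m N → ℕ → Set
HasRank A r = (∃ λ S → CircuitFree A S × ∣ S ∣ ≡ r)
            × (∀ S → CircuitFree A S → ∣ S ∣ ≤ r)

Simple : ∀ {m N} → Matrix₂ m N → Set
Simple A = ∀ C → Circuit A C → ¬ (∣ C ∣ ≡ 1) × ¬ (∣ C ∣ ≡ 2)

colourClass : ∀ {N} → (Fin N → ℕ) → Fin N → Subset N
colourClass c e = tabulate λ f → c f Data.Nat.≡ᵇ c e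

ClassesOfSizeTwo : ∀ {N} → (Fin N → ℕ) → Set
ClassesOfSizeTwo c = ∀ e → ∣ colourClass c e ∣ ≡ 2

Rainbow : ∀ {N} → (Fin N → ℕ) → Subset N → Set
Rainbow c S = ∀ e f → e ∈ S → f ∈ S → c e ≡ c f → e ≡ f

module Submission where

-- Write n = 2 + 2k with k ≥ 2.  The elements are a₀ … a_{n-1} and b₀ … b_{n-1};
-- aⱼ and bⱼ get colour j, and bⱼ = aⱼ + e₁.  Apart from the row e₁ the columns aⱼ
-- are the columns of a matrix G whose kernel consists of the vectors π ∈ F₂ⁿ that
-- are constant on the three blocks {0,1}, {2,…,k+1}, {k+2,…,n-1} and whose three
-- block values sum to zero.  For a zero-sum set T of columns, row e₁ says T has an
-- even number of b's, and the remaining rows say that π = (aⱼ ∈ T) xor (bⱼ ∈ T)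
-- lies in ker G.  So either π = 0 (T pairs every aⱼ with bⱼ, hence ∣T∣ ≥ 4 and T is
-- not rainbow), or π covers two blocks (hence ∣T∣ ≥ k + 2 > n/2).

open import Defs
open import Data.Nat using (ℕ; _<_; _≤_; _*_; _∸_)
open import Data.Nat.Divisibility using (_∣_)
open import Data.Fin using (Fin)
open import Data.Fin.Subset using (∣_∣)
open import Data.Product using (Σ; _×_; ∃)

open import Algebra.Bundles using (CommutativeRing)
open import Data.Bool using (Bool; true; false; _∧_; _∨_; _xor_; if_then_else_)
open import Data.Bool.Properties
  using (xor-∧-commutativeRing; xor-assoc; xor-comm; xor-identityʳ; ∧-assoc;
         ∧-identityʳ; ∧-zeroʳ; ∨-identityʳ; ∧-distribˡ-xor; ∧-distribʳ-xor; ¬-not)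
  renaming (_≟_ to _≟𝔹_)
open import Data.Empty using (⊥; ⊥-elim)
open import Data.Fin using (zero; suc; toℕ; fromℕ<)
open import Data.Fin.Properties using (toℕ<n; toℕ-fromℕ<; any?; all?)
open import Data.Fin.Subset using (Subset; _∈_; _∉_; _⊆_; _⊂_; _∪_; _-_; ⁅_⁆; Nonempty)
open import Data.Fin.Subset.Properties
  using (_∈?_; _⊂?_; nonempty?; anySubset?; ∪-identityʳ; p─⊥≡p; p─q⊆p; p⊆p∪q;
         x∈p∪q⁻; x∈⁅y⁆⇒x≡y; ∣⁅x⁆∣≡1; drop-∷-⊆; p⊆q⇒∣p∣≤∣q∣; p⊂q⇒∣p∣<∣q∣;
         p⊂q⇒p⊆q; ⊆-⊂-trans)
open import Data.Nat using (zero; suc; _+_; z≤n; s≤s; s≤s⁻¹; z<s; s<s; _≡ᵇ_; _≤ᵇ_; _%_)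
open import Data.Nat.Divisibility using (divides)
open import Data.Nat.DivMod using (m<n⇒m%n≡m; [m+n]%n≡m%n; m%n<n)
open import Data.Nat.Properties
  using (_≟_; _≤?_; ≤-refl; ≤-reflexive; ≤-trans; <-≤-trans; n≤1+n; <⇒≤; <⇒≢; <⇒≱;
         ≰⇒>; m≤m+n; m≤n+m; m≤n⇒m≤1+n; m<n+m; m+1+n≰m; m≢1+m+n; m≢1+n+m; +-suc; +-comm; +-assoc;
         +-identityʳ; +-mono-≤; +-monoˡ-≤; +-monoʳ-≤; +-monoʳ-<; *-monoʳ-≤; suc-injective;
         +-commutativeSemigroup)
open import Data.Nat.Tactic.RingSolver using (solve-∀)
open import Data.Product using (_,_; proj₁; proj₂)
open import Data.Sum using (_⊎_; inj₁; inj₂; [_,_]′)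
open import Data.Vec using (_∷_; []; here; there; lookup; tabulate; foldr′)
open import Data.Vec.Properties using ([]=⇒lookup; lookup⇒[]=)
open import Function using (_∘_)
open import Relation.Binary.PropositionalEquality
  using (_≡_; _≢_; refl; sym; trans; cong; cong₂; subst; subst₂; module ≡-Reasoning)
open import Relation.Nullary using (¬_; yes; no; contradiction)
open import Relation.Nullary.Decidable using (dec-true; dec-false; _×-dec_)

open import Algebra.Properties.CommutativeSemigroup
  (CommutativeRing.+-commutativeSemigroup xor-∧-commutativeRing)
  using () renaming (interchange to xor-interchange)
open import Algebra.Properties.CommutativeSemigroup +-commutativeSemigroup
  using () renaming (interchange to +-interchange)

open ≡-Reasoning

≡ᵇ-refl : ∀ i → (i ≡ᵇ i) ≡ true
≡ᵇ-refl i = dec-true (i ≟ i) refl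

≡ᵇ-false : ∀ {i j} → i ≢ j → (i ≡ᵇ j) ≡ false
≡ᵇ-false {i} {j} i≢j = dec-false (i ≟ j) i≢j

≤ᵇ-true : ∀ {i j} → i ≤ j → (i ≤ᵇ j) ≡ true
≤ᵇ-true {i} {j} i≤j = dec-true (i ≤? j) i≤j

≤ᵇ-false : ∀ {i j} → ¬ i ≤ j → (i ≤ᵇ j) ≡ false
≤ᵇ-false {i} {j} i≰j = dec-false (i ≤? j) i≰j

xor≡false⇒≡ : ∀ {a b} → a xor b ≡ false → a ≡ b
xor≡false⇒≡ {false} {false} _ = refl
xor≡false⇒≡ {true}  {true}  _ = refl

⊕ : ∀ {N} → (Fin N → Bool) → Bool
⊕ f = foldr′ _xor_ false (tabulate f)

⊕-cong : ∀ {N} {f g : Fin N → Bool} → (∀ e → f e ≡ g e) → ⊕ f ≡ ⊕ g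
⊕-cong {zero}  f≗g = refl
⊕-cong {suc N} f≗g = cong₂ _xor_ (f≗g zero) (⊕-cong (f≗g ∘ suc))

⊕-vanish : ∀ {N} {f : Fin N → Bool} → (∀ e → f e ≡ false) → ⊕ f ≡ false
⊕-vanish {zero}  f≗0 = refl
⊕-vanish {suc N} f≗0 = cong₂ _xor_ (f≗0 zero) (⊕-vanish (f≗0 ∘ suc))

⊕-xor : ∀ {N} (f g : Fin N → Bool) → ⊕ (λ e → f e xor g e) ≡ ⊕ f xor ⊕ g
⊕-xor {zero}  f g = refl
⊕-xor {suc N} f g =
  trans (cong ((f zero xor g zero) xor_) (⊕-xor (f ∘ suc) (g ∘ suc)))
        (xor-interchange (f zero) (g zero) _ _)

⊕-∧ʳ : ∀ {N} (f : Fin N → Bool) c → ⊕ (λ e → f e ∧ c) ≡ ⊕ f ∧ c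
⊕-∧ʳ {zero}  f c = refl
⊕-∧ʳ {suc N} f c =
  trans (cong ((f zero ∧ c) xor_) (⊕-∧ʳ (f ∘ suc) c)) (sym (∧-distribʳ-xor c (f zero) _))

ZeroSum : ∀ {m N} → Matrix₂ m N → Subset N → Set
ZeroSum A T = ∀ i → colSum A T i ≡ false

colSum-vanish : ∀ {m N} (A : Matrix₂ m N) (T : Subset N) i →
                (∀ {e} → e ∈ T → A e i ≡ false) → colSum A T i ≡ false
colSum-vanish A T i off = ⊕-vanish term
  where
  term : ∀ e → lookup T e ∧ A e i ≡ false
  term e with lookup T e in e∈T
  ... | false = refl
  ... | true  = off (lookup⇒[]= e T e∈T)

colSum-insert : ∀ {m N} (A : Matrix₂ m N) (T : Subset N) {e} i → e ∉ T →
                colSum A (T ∪ ⁅ e ⁆) i ≡ colSum A T i xor A e i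
colSum-insert A (true  ∷ T) {zero}  i e∉T = ⊥-elim (e∉T (here))
colSum-insert A (false ∷ T) {zero}  i e∉T =
  trans (cong (λ U → A zero i xor colSum (A ∘ suc) U i) (∪-identityʳ T)) (xor-comm (A zero i) _)
colSum-insert A (b ∷ T)     {suc e} i e∉T = begin
  ((b ∨ false) ∧ A zero i) xor colSum (A ∘ suc) (T ∪ ⁅ e ⁆) i
    ≡⟨ cong₂ (λ x y → (x ∧ A zero i) xor y) (∨-identityʳ b)
             (colSum-insert (A ∘ suc) T i (e∉T ∘ there)) ⟩
  (b ∧ A zero i) xor (colSum (A ∘ suc) T i xor A (suc e) i)
    ≡⟨ xor-assoc (b ∧ A zero i) _ _ ⟨
  ((b ∧ A zero i) xor colSum (A ∘ suc) T i) xor A (suc e) i ∎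

-- Gaussian elimination of row zero against a pivot column e₀: add the entry of
-- e₀ in row r + 1 times row zero to row r + 1, and drop row zero.
pivotRows : ∀ {m N} → Matrix₂ (suc m) N → Fin N → Matrix₂ m N
pivotRows A e₀ e r = A e (suc r) xor (A e zero ∧ A e₀ (suc r))

colSum-pivot : ∀ {m N} (A : Matrix₂ (suc m) N) e₀ T r →
  colSum (pivotRows A e₀) T r ≡ colSum A T (suc r) xor (colSum A T zero ∧ A e₀ (suc r))
colSum-pivot A e₀ T r = begin
  ⊕ (λ e → lookup T e ∧ pivotRows A e₀ e r)
    ≡⟨ ⊕-cong distribute ⟩
  ⊕ (λ e → (lookup T e ∧ A e (suc r)) xor ((lookup T e ∧ A e zero) ∧ A e₀ (suc r)))
    ≡⟨ ⊕-xor (λ e → lookup T e ∧ A e (suc r)) (λ e → (lookup T e ∧ A e zero) ∧ A e₀ (suc r)) ⟩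
  colSum A T (suc r) xor ⊕ (λ e → (lookup T e ∧ A e zero) ∧ A e₀ (suc r))
    ≡⟨ cong (colSum A T (suc r) xor_) (⊕-∧ʳ (λ e → lookup T e ∧ A e zero) (A e₀ (suc r))) ⟩
  colSum A T (suc r) xor (colSum A T zero ∧ A e₀ (suc r)) ∎
  where
  distribute : ∀ e → lookup T e ∧ pivotRows A e₀ e r
                   ≡ (lookup T e ∧ A e (suc r)) xor ((lookup T e ∧ A e zero) ∧ A e₀ (suc r))
  distribute e = trans (∧-distribˡ-xor (lookup T e) _ _)
                       (cong ((lookup T e ∧ A e (suc r)) xor_) (sym (∧-assoc (lookup T e) _ _)))

-- A zero-sum set of the reduced matrix that avoids the pivot lifts to a zero-sum
-- set of A, by adding the pivot exactly when row zero needs clearing.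
pivotLift : ∀ {m N} (A : Matrix₂ (suc m) N) {e₀} (T : Subset N) →
  A e₀ zero ≡ true → e₀ ∉ T → ZeroSum (pivotRows A e₀) T →
  ∃ λ U → T ⊆ U × U ⊆ T ∪ ⁅ e₀ ⁆ × ZeroSum A U
pivotLift A {e₀} T pivot e₀∉T reduced with colSum A T zero in row₀
... | false = T , (λ x∈T → x∈T) , p⊆p∪q ⁅ e₀ ⁆ , sums
  where
  sums : ZeroSum A T
  sums zero    = row₀
  sums (suc r) = begin
    colSum A T (suc r)                                         ≡⟨ xor-identityʳ _ ⟨
    colSum A T (suc r) xor false                               ≡⟨ cong (λ b → colSum A T (suc r) xor (b ∧ A e₀ (suc r))) row₀ ⟨
    colSum A T (suc r) xor (colSum A T zero ∧ A e₀ (suc r))    ≡⟨ colSum-pivot A e₀ T r ⟨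
    colSum (pivotRows A e₀) T r                                ≡⟨ reduced r ⟩
    false                                                      ∎
... | true = T ∪ ⁅ e₀ ⁆ , p⊆p∪q ⁅ e₀ ⁆ , (λ x∈U → x∈U) , sums
  where
  sums : ZeroSum A (T ∪ ⁅ e₀ ⁆)
  sums zero    = trans (colSum-insert A T zero e₀∉T) (cong₂ _xor_ row₀ pivot)
  sums (suc r) = begin
    colSum A (T ∪ ⁅ e₀ ⁆) (suc r)                              ≡⟨ colSum-insert A T (suc r) e₀∉T ⟩
    colSum A T (suc r) xor A e₀ (suc r)                        ≡⟨ cong (λ b → colSum A T (suc r) xor (b ∧ A e₀ (suc r))) row₀ ⟨
    colSum A T (suc r) xor (colSum A T zero ∧ A e₀ (suc r))    ≡⟨ colSum-pivot A e₀ T r ⟨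
    colSum (pivotRows A e₀) T r                                ≡⟨ reduced r ⟩
    false                                                      ∎

nonempty-of-size : ∀ {N} (p : Subset N) → 0 < ∣ p ∣ → Nonempty p
nonempty-of-size (true  ∷ p) _   = zero , here
nonempty-of-size (false ∷ p) pos with nonempty-of-size p pos
... | x , x∈p = suc x , there x∈p

size-of-nonempty : ∀ {N} {p : Subset N} → Nonempty p → 0 < ∣ p ∣
size-of-nonempty {p = p} (x , x∈p) = subst (_≤ ∣ p ∣) (∣⁅x⁆∣≡1 x) (p⊆q⇒∣p∣≤∣q∣ ⁅x⁆⊆p)
  where
  ⁅x⁆⊆p : ⁅ x ⁆ ⊆ p
  ⁅x⁆⊆p y∈⁅x⁆ = subst (_∈ p) (sym (x∈⁅y⁆⇒x≡y x y∈⁅x⁆)) x∈p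

remove-size : ∀ {N} (p : Subset N) {x} → x ∈ p → ∣ p ∣ ≡ suc ∣ p - x ∣
remove-size (true  ∷ p) {zero}  _ = cong suc (sym (cong ∣_∣ (p─⊥≡p p)))
remove-size (true  ∷ p) {suc x} (there x∈p) = cong suc (remove-size p x∈p)
remove-size (false ∷ p) {suc x} (there x∈p) = remove-size p x∈p

removed-∉ : ∀ {N} (p : Subset N) x → x ∉ p - x
removed-∉ (_ ∷ p) (suc x) (there x∈p-x) = removed-∉ p x x∈p-x

-- Either no
-- column of S meets row zero, and row zero can be dropped, or some column e₀
-- does, and we eliminate row zero against it and lift back with `pivotLift`.
largeDependent : ∀ m {N} (A : Matrix₂ m N) (S : Subset N) → m < ∣ S ∣ → Dependent A S
largeDependent zero A S pos = S , (λ x∈S → x∈S) , nonempty-of-size S pos , λ ()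
largeDependent (suc m) A S m<∣S∣ with any? (λ e → (e ∈? S) ×-dec (A e zero ≟𝔹 true))
... | no noPivot with largeDependent m (λ e r → A e (suc r)) S (≤-trans (n≤1+n _) m<∣S∣)
...   | T , T⊆S , neT , lower = T , T⊆S , neT , sums
  where
  sums : ZeroSum A T
  sums zero    = colSum-vanish A T zero (λ {e} e∈T → ¬-not (λ one → noPivot (e , T⊆S e∈T , one)))
  sums (suc r) = lower r
largeDependent (suc m) A S m<∣S∣ | yes (e₀ , e₀∈S , pivot)
  with largeDependent m (pivotRows A e₀) (S - e₀) (s≤s⁻¹ (subst (suc m <_) (remove-size S e₀∈S) m<∣S∣))
...   | T , T⊆S-e₀ , (x , x∈T) , reduced
  with pivotLift A T pivot (λ e₀∈T → removed-∉ S e₀ (T⊆S-e₀ e₀∈T)) reduced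
...     | U , T⊆U , U⊆T+e₀ , sums = U , U⊆S , (x , T⊆U x∈T) , sums
  where
  U⊆S : U ⊆ S
  U⊆S y∈U = [ (λ y∈T → p─q⊆p S ⁅ e₀ ⁆ (T⊆S-e₀ y∈T))
            , (λ y∈⁅e₀⁆ → subst (_∈ S) (sym (x∈⁅y⁆⇒x≡y e₀ y∈⁅e₀⁆)) e₀∈S) ]′
            (x∈p∪q⁻ T ⁅ e₀ ⁆ (U⊆T+e₀ y∈U))

-- Every nonempty zero-sum set contains a circuit: while some proper nonempty
-- subset is still zero-sum, pass to it (the bound on ∣ T ∣ drives the recursion).
circuitWithin : ∀ {m N} (A : Matrix₂ m N) bound (T : Subset N) → ∣ T ∣ < bound →
                Nonempty T → ZeroSum A T → ∃ λ C → C ⊆ T × Circuit A C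
circuitWithin A (suc bound) T ∣T∣≤bound neT sumsT
  with anySubset? (λ U → (U ⊂? T) ×-dec (nonempty? U ×-dec all? (λ i → colSum A U i ≟𝔹 false)))
... | yes (U , U⊂T , neU , sumsU)
  with circuitWithin A bound U (<-≤-trans (p⊂q⇒∣p∣<∣q∣ U⊂T) (s≤s⁻¹ ∣T∣≤bound)) neU sumsU
...   | C , C⊆U , circuit = C , (λ y∈C → p⊂q⇒p⊆q U⊂T (C⊆U y∈C)) , circuit
circuitWithin A (suc bound) T _ neT sumsT | no minimal =
  T , (λ y∈T → y∈T) , (T , (λ y∈T → y∈T) , neT , sumsT) , noSmaller
  where
  noSmaller : ∀ D → D ⊂ T → ¬ Dependent A D
  noSmaller D D⊂T (U , U⊆D , neU , sumsU) = minimal (U , ⊆-⊂-trans U⊆D D⊂T , neU , sumsU)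

circuitFree-size : ∀ {m N} (A : Matrix₂ m N) (S : Subset N) → CircuitFree A S → ∣ S ∣ ≤ m
circuitFree-size {m} A S free with ∣ S ∣ ≤? m
... | yes small = small
... | no large with largeDependent m A S (≰⇒> large)
...   | T , T⊆S , neT , sumsT with circuitWithin A (suc ∣ T ∣) T ≤-refl neT sumsT
...     | C , C⊆T , circuit = ⊥-elim (free C circuit (λ y∈C → T⊆S (C⊆T y∈C)))

independent⇒circuitFree : ∀ {m N} (A : Matrix₂ m N) (S : Subset N) →
  (∀ T → T ⊆ S → Nonempty T → ¬ ZeroSum A T) → CircuitFree A S
independent⇒circuitFree A S indep C ((T , T⊆C , neT , sumsT) , _) C⊆S =
  indep T (λ y∈T → C⊆S (T⊆C y∈T)) neT sumsT

parity : (ℕ → Bool) → ℕ → Bool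
parity g k = ⊕ {k} (λ j → g (toℕ j))

parity-cong : ∀ {f g : ℕ → Bool} k → (∀ j → j < k → f j ≡ g j) → parity f k ≡ parity g k
parity-cong k f≗g = ⊕-cong (λ e → f≗g (toℕ e) (toℕ<n e))

parity-vanish : ∀ {g : ℕ → Bool} k → (∀ j → j < k → g j ≡ false) → parity g k ≡ false
parity-vanish k g≗0 = ⊕-vanish (λ e → g≗0 (toℕ e) (toℕ<n e))

parity-xor : ∀ (f g : ℕ → Bool) k → parity (λ j → f j xor g j) k ≡ parity f k xor parity g k
parity-xor f g k = ⊕-xor {k} (λ e → f (toℕ e)) (λ e → g (toℕ e))

parity-split : ∀ (g : ℕ → Bool) a k → parity g (a + k) ≡ parity g a xor parity (λ j → g (a + j)) k
parity-split g zero    k = refl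
parity-split g (suc a) k =
  trans (cong (g 0 xor_) (parity-split (g ∘ suc) a k)) (sym (xor-assoc (g 0) _ _))

parity-double : ∀ (g : ℕ → Bool) n → parity g (2 * n) ≡ parity g n xor parity (λ j → g (n + j)) n
parity-double g n =
  trans (parity-split g n (n + 0)) (cong (λ l → parity g n xor parity (λ j → g (n + j)) l) (+-identityʳ n))

parity-point : ∀ (g : ℕ → Bool) {i k} → i < k → parity (λ j → g j ∧ (j ≡ᵇ i)) k ≡ g i
parity-point g {zero}  {suc k} _ = begin
  (g 0 ∧ true) xor parity (λ j → g (suc j) ∧ false) k
    ≡⟨ cong₂ _xor_ (∧-identityʳ (g 0)) (parity-vanish k (λ j _ → ∧-zeroʳ (g (suc j)))) ⟩
  g 0 xor false  ≡⟨ xor-identityʳ (g 0) ⟩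
  g 0            ∎
parity-point g {suc i} {suc k} i<k =
  trans (cong (_xor parity (λ j → g (suc j) ∧ (j ≡ᵇ i)) k) (∧-zeroʳ (g 0)))
        (parity-point (g ∘ suc) (s≤s⁻¹ i<k))

parity-pair : ∀ (g : ℕ → Bool) {u w k} → u < k → w < k →
              parity (λ j → g j ∧ ((j ≡ᵇ u) xor (j ≡ᵇ w))) k ≡ g u xor g w
parity-pair g {u} {w} {k} u<k w<k = begin
  parity (λ j → g j ∧ ((j ≡ᵇ u) xor (j ≡ᵇ w))) k
    ≡⟨ parity-cong k (λ j _ → ∧-distribˡ-xor (g j) (j ≡ᵇ u) (j ≡ᵇ w)) ⟩
  parity (λ j → (g j ∧ (j ≡ᵇ u)) xor (g j ∧ (j ≡ᵇ w))) k
    ≡⟨ parity-xor (λ j → g j ∧ (j ≡ᵇ u)) (λ j → g j ∧ (j ≡ᵇ w)) k ⟩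
  parity (λ j → g j ∧ (j ≡ᵇ u)) k xor parity (λ j → g j ∧ (j ≡ᵇ w)) k
    ≡⟨ cong₂ _xor_ (parity-point g u<k) (parity-point g w<k) ⟩
  g u xor g w ∎

parity-triple : ∀ (g : ℕ → Bool) {u v w k} → u < k → v < k → w < k →
  parity (λ j → g j ∧ ((j ≡ᵇ u) xor ((j ≡ᵇ v) xor (j ≡ᵇ w)))) k ≡ g u xor (g v xor g w)
parity-triple g {u} {v} {w} {k} u<k v<k w<k =
  trans (parity-cong k (λ j _ → ∧-distribˡ-xor (g j) (j ≡ᵇ u) ((j ≡ᵇ v) xor (j ≡ᵇ w))))
  (trans (parity-xor (λ j → g j ∧ (j ≡ᵇ u)) (λ j → g j ∧ ((j ≡ᵇ v) xor (j ≡ᵇ w))) k) (cong₂ _xor_ (parity-point g u<k) (parity-pair g v<k w<k)))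

weight : Bool → ℕ → ℕ
weight b l = if b then l else 0

count : (ℕ → Bool) → ℕ → ℕ
count g zero    = 0
count g (suc k) = weight (g 0) 1 + count (g ∘ suc) k

count-cong : ∀ {f g : ℕ → Bool} k → (∀ j → j < k → f j ≡ g j) → count f k ≡ count g k
count-cong zero    f≗g = refl
count-cong (suc k) f≗g =
  cong₂ (λ b c → weight b 1 + c) (f≗g 0 z<s) (count-cong k (λ j j<k → f≗g (suc j) (s<s j<k)))

count-split : ∀ (g : ℕ → Bool) a k → count g (a + k) ≡ count g a + count (λ j → g (a + j)) k
count-split g zero    k = refl
count-split g (suc a) k =
  trans (cong (weight (g 0) 1 +_) (count-split (g ∘ suc) a k)) (sym (+-assoc (weight (g 0) 1) _ _))

count-double : ∀ (g : ℕ → Bool) n → count g (2 * n) ≡ count g n + count (λ j → g (n + j)) n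
count-double g n =
  trans (count-split g n (n + 0)) (cong (λ l → count g n + count (λ j → g (n + j)) l) (+-identityʳ n))

count-const : ∀ {g : ℕ → Bool} b k → (∀ j → j < k → g j ≡ b) → count g k ≡ weight b k
count-const true  zero _   = refl
count-const false zero _   = refl
count-const b (suc k) g≗b =
  trans (cong₂ (λ x c → weight x 1 + c) (g≗b 0 z<s) (count-const b k (λ j j<k → g≗b (suc j) (s<s j<k))))
        (runs b)
  where
  runs : ∀ b → weight b 1 + weight b k ≡ weight b (suc k)
  runs true  = refl
  runs false = refl

count-point : ∀ {i} k → i < k → count (λ j → j ≡ᵇ i) k ≡ 1
count-point {zero}  (suc k) _   = cong suc (count-const false k (λ _ _ → refl))
count-point {suc i} (suc k) i<k = count-point k (s≤s⁻¹ i<k)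

count-xor : ∀ (f g : ℕ → Bool) k → count (λ j → f j xor g j) k ≤ count f k + count g k
count-xor f g zero    = z≤n
count-xor f g (suc k) =
  ≤-trans (+-mono-≤ (pointwise (f 0) (g 0)) (count-xor (f ∘ suc) (g ∘ suc) k))
          (≤-reflexive (+-interchange (weight (f 0) 1) _ _ _))
  where
  pointwise : ∀ a b → weight (a xor b) 1 ≤ weight a 1 + weight b 1
  pointwise false false = z≤n
  pointwise false true  = ≤-refl
  pointwise true  false = ≤-refl
  pointwise true  true  = z≤n

head-zero : ∀ b c → weight b 1 + c ≡ 0 → b ≡ false × c ≡ 0
head-zero false c c≡0 = refl , c≡0

head-one : ∀ b c → weight b 1 + c ≡ 1 → (b ≡ true × c ≡ 0) ⊎ (b ≡ false × c ≡ 1)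
head-one true  c c≡0 = inj₁ (refl , suc-injective c≡0)
head-one false c c≡1 = inj₂ (refl , c≡1)

head-pos : ∀ b c → 0 < weight b 1 + c → b ≡ true ⊎ 0 < c
head-pos true  c _   = inj₁ refl
head-pos false c pos = inj₂ pos

count≡0 : ∀ (g : ℕ → Bool) k → count g k ≡ 0 → ∀ j → j < k → g j ≡ false
count≡0 g (suc k) none zero    _   = proj₁ (head-zero (g 0) _ none)
count≡0 g (suc k) none (suc j) j<k =
  count≡0 (g ∘ suc) k (proj₂ (head-zero (g 0) _ none)) j (s≤s⁻¹ j<k)

count-witness : ∀ (g : ℕ → Bool) k → 0 < count g k → ∃ λ j → j < k × g j ≡ true
count-witness g (suc k) pos with head-pos (g 0) _ pos
... | inj₁ g0 = 0 , z<s , g0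
... | inj₂ rest with count-witness (g ∘ suc) k rest
...   | j , j<k , gj = suc j , s<s j<k , gj

count≡1⇒parity : ∀ (g : ℕ → Bool) k → count g k ≡ 1 → parity g k ≡ true
count≡1⇒parity g (suc k) one with head-one (g 0) _ one
... | inj₁ (g0 , none) = cong₂ _xor_ g0 (parity-vanish k (count≡0 (g ∘ suc) k none))
... | inj₂ (g0 , one′) = cong₂ _xor_ g0 (count≡1⇒parity (g ∘ suc) k one′)

-- Subsets of Fin N as boolean sequences on ℕ: `ind p j` says whether j ∈ p
-- (false beyond N).

ind : ∀ {N} → Subset N → ℕ → Bool
ind []      _       = false
ind (b ∷ p) zero    = b
ind (b ∷ p) (suc j) = ind p j

ind-lookup : ∀ {N} (p : Subset N) e → ind p (toℕ e) ≡ lookup p e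
ind-lookup (b ∷ p) zero    = refl
ind-lookup (b ∷ p) (suc e) = ind-lookup p e

ind-tabulate : ∀ {N} (g : ℕ → Bool) {j} → j < N → ind (tabulate {n = N} (λ e → g (toℕ e))) j ≡ g j
ind-tabulate {suc N} g {zero}  _   = refl
ind-tabulate {suc N} g {suc j} j<N = ind-tabulate (g ∘ suc) (s≤s⁻¹ j<N)

ind-mono : ∀ {N} {p q : Subset N} → p ⊆ q → ∀ j → ind p j ≡ true → ind q j ≡ true
ind-mono {p = true ∷ p} {q = b ∷ q} p⊆q zero    _ = []=⇒lookup (p⊆q here)
ind-mono {p = a ∷ p}    {q = b ∷ q} p⊆q (suc j) = ind-mono (drop-∷-⊆ p⊆q) j

ind-∈ : ∀ {N} (p : Subset N) {j} (j<N : j < N) → ind p j ≡ true → fromℕ< j<N ∈ p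
ind-∈ (true ∷ p) {zero}  _   _  = here
ind-∈ (b ∷ p)    {suc j} j<N pj = there (ind-∈ p (s≤s⁻¹ j<N) pj)

∣p∣≡count : ∀ {N} (p : Subset N) → ∣ p ∣ ≡ count (ind p) N
∣p∣≡count []          = refl
∣p∣≡count (true  ∷ p) = cong suc (∣p∣≡count p)
∣p∣≡count (false ∷ p) = ∣p∣≡count p

constantRun : ∀ (g : ℕ → Bool) a len → (∀ i → suc i < len → g (a + i) ≡ g (a + suc i)) →
              ∀ i → i < len → g (a + i) ≡ g a
constantRun g a len step zero    _         = cong g (+-identityʳ a)
constantRun g a len step (suc i) 1+i<len =
  trans (sym (step i 1+i<len)) (constantRun g a len step i (<⇒≤ 1+i<len))

two≤ : ∀ {c} → 0 < c → c ≢ 1 → 2 ≤ c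
two≤ {suc zero}    _ c≢1 = contradiction refl c≢1
two≤ {suc (suc c)} _ _   = s≤s (s≤s z≤n)

half-positive : ∀ c → 0 < c + c → 0 < c
half-positive (suc c) _ = z<s

double-shift : ∀ k → 2 * (2 + k) ≡ 2 + (2 + (k + k))
double-shift = solve-∀

Witness : ℕ → Set
Witness n = ∃ λ (m : ℕ) → Σ (Matrix₂ m (2 * n)) λ A → Σ (Fin (2 * n) → ℕ) λ c →
  Simple A × HasRank A (n ∸ 1) × ClassesOfSizeTwo c ×
  (∀ C → Circuit A C → Rainbow c C → n < 2 * ∣ C ∣)

module Construction (t : ℕ) where

  k : ℕ
  k = 2 + t

  n : ℕ
  n = 2 + (k + k)

  N : ℕ
  N = 2 * n

  m : ℕ
  m = n ∸ 1

  -- Element j < n is aⱼ and element n + j is bⱼ; both have colour j.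
  colour : ℕ → ℕ
  colour j = j % n

  isB : ℕ → Bool
  isB j = n ≤ᵇ j

  colour-low : ∀ {j} → j < n → colour j ≡ j
  colour-low = m<n⇒m%n≡m

  colour-high : ∀ {j} → j < n → colour (n + j) ≡ j
  colour-high {j} j<n = trans (cong (_% n) (+-comm n j)) (trans ([m+n]%n≡m%n j n) (m<n⇒m%n≡m j<n))

  isB-low : ∀ {j} → j < n → isB j ≡ false
  isB-low j<n = ≤ᵇ-false (<⇒≱ j<n)

  isB-high : ∀ j → isB (n + j) ≡ true
  isB-high j = ≤ᵇ-true (m≤m+n n j)

  a<N : ∀ {j} → j < n → j < N
  a<N j<n = ≤-trans j<n (m≤m+n n (n + 0))

  b<N : ∀ {j} → j < n → n + j < N
  b<N j<n = +-monoʳ-< n (≤-trans j<n (m≤m+n n 0))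

  k<k+k : k < k + k
  k<k+k = s≤s (m≤n+m k (suc t))

  -- Rows of the colour matrix G: `link r` forces π r = π (r + 1); it is used for
  -- consecutive colours inside a block.  Row k + 1, between the blocks
  -- {2,…,k+1} and {k+2,…,n-1}, is `balance` instead, forcing the three block
  -- values π 0, π 2, π (2 + k) to sum to zero.
  link : ℕ → ℕ → Bool
  link r c = (c ≡ᵇ r) xor (c ≡ᵇ suc r)

  balance : ℕ → Bool
  balance c = (c ≡ᵇ 0) xor ((c ≡ᵇ 2) xor (c ≡ᵇ 2 + k))

  colourRow : ℕ → ℕ → Bool
  colourRow r = if r ≡ᵇ suc k then balance else link r

  -- Row 1, which would link the blocks {0,1} and {2,…,k+1}, instead marks the b's.
  entry : ℕ → ℕ → Bool → Bool
  entry 1 _ b = b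
  entry r c _ = colourRow r c

  entry-colour : ∀ {r} → r ≢ 1 → ∀ c b → entry r c b ≡ colourRow r c
  entry-colour {zero}        _   c b = refl
  entry-colour {suc zero}    r≢1 c b = contradiction refl r≢1
  entry-colour {suc (suc r)} _   c b = refl

  M : Matrix₂ m N
  M e r = entry (toℕ r) (colour (toℕ e)) (isB (toℕ e))

  colouring : Fin N → ℕ
  colouring e = colour (toℕ e)

  colSum-M : ∀ (T : Subset N) r → colSum M T r ≡
    parity (λ j → ind T j ∧ entry (toℕ r) j false) n xor
    parity (λ j → ind T (n + j) ∧ entry (toℕ r) j true) n
  colSum-M T r = begin
    colSum M T r
      ≡⟨ ⊕-cong (λ e → cong (_∧ M e r) (sym (ind-lookup T e))) ⟩
    parity g N
      ≡⟨ parity-double g n ⟩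
    parity g n xor parity (λ j → g (n + j)) n
      ≡⟨ cong₂ _xor_ (parity-cong n low) (parity-cong n high) ⟩
    parity (λ j → ind T j ∧ entry (toℕ r) j false) n xor
    parity (λ j → ind T (n + j) ∧ entry (toℕ r) j true) n ∎
    where
    g : ℕ → Bool
    g j = ind T j ∧ entry (toℕ r) (colour j) (isB j)
    low : ∀ j → j < n → g j ≡ ind T j ∧ entry (toℕ r) j false
    low j j<n = cong₂ (λ c b → ind T j ∧ entry (toℕ r) c b) (colour-low j<n) (isB-low j<n)
    high : ∀ j → j < n → g (n + j) ≡ ind T (n + j) ∧ entry (toℕ r) j true
    high j j<n = cong₂ (λ c b → ind T (n + j) ∧ entry (toℕ r) c b) (colour-high j<n) (isB-high j)

  record InKernel (π : ℕ → Bool) : Set where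
    field
      link₀    : π 0 ≡ π 1
      link₁    : ∀ i → suc i < k → π (2 + i) ≡ π (2 + suc i)
      link₂    : ∀ i → suc i < k → π (2 + k + i) ≡ π (2 + k + suc i)
      balanced : π 0 xor (π 2 xor π (2 + k)) ≡ false

  blockCount : ∀ {π} → InKernel π → count π n ≡ weight (π 0) 2 + (weight (π 2) k + weight (π (2 + k)) k)
  blockCount {π} κ = begin
    count π (2 + (k + k))
      ≡⟨ count-split π 2 (k + k) ⟩
    count π 2 + count (λ j → π (2 + j)) (k + k)
      ≡⟨ cong (count π 2 +_) (count-split (λ j → π (2 + j)) k k) ⟩
    count π 2 + (count (λ j → π (2 + j)) k + count (λ j → π (2 + (k + j))) k)
      ≡⟨ cong₂ _+_ (count-const (π 0) 2 block₀)
           (cong₂ _+_ (count-const (π 2) k (constantRun π 2 k link₁))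
                      (count-const (π (2 + k)) k (constantRun π (2 + k) k link₂))) ⟩
    weight (π 0) 2 + (weight (π 2) k + weight (π (2 + k)) k) ∎
    where
    open InKernel κ
    block₀ : ∀ j → j < 2 → π j ≡ π 0
    block₀ zero       _ = refl
    block₀ (suc zero) _ = sym link₀
    block₀ (suc (suc j)) (s≤s (s≤s ()))

  twoBlocks : ∀ x y z → x xor (y xor z) ≡ false →
    weight x 2 + (weight y k + weight z k) ≡ 0 ⊎ 2 + k ≤ weight x 2 + (weight y k + weight z k)
  twoBlocks false false false _ = inj₁ refl
  twoBlocks true  true  false _ = inj₂ (≤-reflexive (cong (2 +_) (sym (+-identityʳ k))))
  twoBlocks true  false true  _ = inj₂ ≤-refl
  twoBlocks false true  true  _ = inj₂ (+-monoˡ-≤ k (s≤s (s≤s z≤n)))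
  twoBlocks true  true  true  ()
  twoBlocks true  false false ()
  twoBlocks false true  false ()
  twoBlocks false false true  ()

  kernelDichotomy : ∀ {π} → InKernel π → count π n ≡ 0 ⊎ 2 + k ≤ count π n
  kernelDichotomy {π} κ =
    subst (λ c → c ≡ 0 ⊎ 2 + k ≤ c) (sym (blockCount κ)) (twoBlocks (π 0) (π 2) (π (2 + k)) (InKernel.balanced κ))

  kernelPinned : ∀ {π} → InKernel π → π 0 ≡ false → π 2 ≡ false → count π n ≡ 0
  kernelPinned {π} κ π₀ π₂ = begin
    count π n                                                   ≡⟨ blockCount κ ⟩
    weight (π 0) 2 + (weight (π 2) k + weight (π (2 + k)) k)    ≡⟨ cong₂ (λ x y → weight x 2 + (weight y k + weight (π (2 + k)) k)) π₀ π₂ ⟩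
    weight (π (2 + k)) k                                        ≡⟨ cong (λ z → weight z k) πₖ ⟩
    0                                                           ∎
    where
    πₖ : π (2 + k) ≡ false
    πₖ = subst₂ (λ x y → x xor (y xor π (2 + k)) ≡ false) π₀ π₂ (InKernel.balanced κ)

  module ZeroSumSet (T : Subset N) (sums : ZeroSum M T) where

    Ta : ℕ → Bool
    Ta j = ind T j

    Tb : ℕ → Bool
    Tb j = ind T (n + j)

    π : ℕ → Bool
    π j = Ta j xor Tb j

    rowEquation : ∀ r → r < m →
      parity (λ j → Ta j ∧ entry r j false) n xor parity (λ j → Tb j ∧ entry r j true) n ≡ false
    rowEquation r r<m =
      subst (λ ρ → parity (λ j → Ta j ∧ entry ρ j false) n xor parity (λ j → Tb j ∧ entry ρ j true) n ≡ false)
            (toℕ-fromℕ< r<m) (trans (sym (colSum-M T (fromℕ< r<m))) (sums (fromℕ< r<m)))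

    evenB : parity Tb n ≡ false
    evenB = trans (sym (cong₂ _xor_ (parity-vanish n (λ j _ → ∧-zeroʳ (Ta j)))
                                    (parity-cong n (λ j _ → ∧-identityʳ (Tb j)))))
                  (rowEquation 1 (s≤s (s≤s z≤n)))

    -- Every other row only sees colours, so it is orthogonal to π.
    colourEquation : ∀ r → r < m → r ≢ 1 → parity (λ j → π j ∧ colourRow r j) n ≡ false
    colourEquation r r<m r≢1 = begin
      parity (λ j → π j ∧ colourRow r j) n
        ≡⟨ parity-cong n (λ j _ → ∧-distribʳ-xor (colourRow r j) (Ta j) (Tb j)) ⟩
      parity (λ j → (Ta j ∧ colourRow r j) xor (Tb j ∧ colourRow r j)) n
        ≡⟨ parity-xor (λ j → Ta j ∧ colourRow r j) (λ j → Tb j ∧ colourRow r j) n ⟩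
      parity (λ j → Ta j ∧ colourRow r j) n xor parity (λ j → Tb j ∧ colourRow r j) n
        ≡⟨ cong₂ _xor_ (parity-cong n (λ j _ → cong (Ta j ∧_) (entry-colour r≢1 j false)))
                       (parity-cong n (λ j _ → cong (Tb j ∧_) (entry-colour r≢1 j true))) ⟨
      parity (λ j → Ta j ∧ entry r j false) n xor parity (λ j → Tb j ∧ entry r j true) n
        ≡⟨ rowEquation r r<m ⟩
      false ∎

    linkEquation : ∀ r → r < m → r ≢ 1 → r ≢ suc k → π r ≡ π (suc r)
    linkEquation r r<m r≢1 r≢1+k = xor≡false⇒≡ (begin
      π r xor π (suc r)                       ≡⟨ parity-pair π (m≤n⇒m≤1+n r<m) (s≤s r<m) ⟨
      parity (λ j → π j ∧ link r j) n         ≡⟨ parity-cong n (λ j _ → cong (π j ∧_) (isLink j)) ⟨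
      parity (λ j → π j ∧ colourRow r j) n    ≡⟨ colourEquation r r<m r≢1 ⟩
      false                                   ∎)
      where
      isLink : ∀ j → colourRow r j ≡ link r j
      isLink j = cong (λ b → (if b then balance else link r) j) (≡ᵇ-false r≢1+k)

    balanceEquation : π 0 xor (π 2 xor π (2 + k)) ≡ false
    balanceEquation = begin
      π 0 xor (π 2 xor π (2 + k))
        ≡⟨ parity-triple π z<s (s≤s (s≤s (s≤s z≤n))) (s≤s (s≤s k<k+k)) ⟨
      parity (λ j → π j ∧ balance j) n
        ≡⟨ parity-cong n (λ j _ → cong (π j ∧_) (isBalance j)) ⟨
      parity (λ j → π j ∧ colourRow (suc k) j) n
        ≡⟨ colourEquation (suc k) (s≤s k<k+k) (λ ()) ⟩
      false ∎
      where
      isBalance : ∀ j → colourRow (suc k) j ≡ balance j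
      isBalance j = cong (λ b → (if b then balance else link (suc k)) j) (≡ᵇ-refl (suc k))

    inKernel : InKernel π
    inKernel = record
      { link₀    = linkEquation 0 z<s (λ ()) (λ ())
      ; link₁    = λ i 1+i<k → linkEquation (2 + i)
                     (s≤s (≤-trans 1+i<k (m≤m+n k k)))
                     (λ ())
                     (λ eq → <⇒≢ 1+i<k (suc-injective eq))
      ; link₂    = λ i 1+i<k → trans
                     (linkEquation (2 + (k + i))
                       (s≤s (≤-trans (≤-reflexive (sym (trans (+-suc k (suc i)) (cong suc (+-suc k i)))))
                                     (+-monoʳ-≤ k 1+i<k)))
                       (λ ())
                       (λ eq → m≢1+m+n k (sym (suc-injective eq))))
                     (cong (λ x → π (2 + x)) (sym (+-suc k i)))
      ; balanced = balanceEquation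
      }

    size : ∣ T ∣ ≡ count Ta n + count Tb n
    size = trans (∣p∣≡count T) (count-double Ta n)

    πBound : count π n ≤ ∣ T ∣
    πBound = subst (count π n ≤_) (sym size) (count-xor Ta Tb n)

    mirrored : count π n ≡ 0 → ∀ j → j < n → Ta j ≡ Tb j
    mirrored none j j<n = xor≡false⇒≡ (count≡0 π n none j j<n)

    mirroredSize : count π n ≡ 0 → ∣ T ∣ ≡ count Tb n + count Tb n
    mirroredSize none = trans size (cong (_+ count Tb n) (count-cong n (mirrored none)))

    mirroredPositive : count π n ≡ 0 → Nonempty T → 0 < count Tb n
    mirroredPositive none neT = half-positive _ (subst (0 <_) (mirroredSize none) (size-of-nonempty neT))

    -- Every nonempty zero-sum set has at least four elements: either π covers two
    -- blocks, or T consists of pairs aⱼ, bⱼ with an even, nonzero number of b's.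
    size≥4 : Nonempty T → 4 ≤ ∣ T ∣
    size≥4 neT = [ mirroredCase , (λ large → ≤-trans (s≤s (s≤s (s≤s (s≤s z≤n)))) (≤-trans large πBound)) ]′
                   (kernelDichotomy inKernel)
      where
      mirroredCase : count π n ≡ 0 → 4 ≤ ∣ T ∣
      mirroredCase none = subst (4 ≤_) (sym (mirroredSize none)) (+-mono-≤ two two)
        where
        two : 2 ≤ count Tb n
        two = two≤ (mirroredPositive none neT)
                   (λ one → contradiction (trans (sym (count≡1⇒parity Tb n one)) evenB) λ ())

    -- A nonempty rainbow zero-sum set has at least 2 + k elements: otherwise it
    -- would contain both aᵢ and bᵢ for some i.
    rainbowSize : Nonempty T → Rainbow colouring T → 2 + k ≤ ∣ T ∣
    rainbowSize neT rainbow =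
      [ (λ none → ⊥-elim (collision none (count-witness Tb n (mirroredPositive none neT))))
      , (λ large → ≤-trans large πBound) ]′ (kernelDichotomy inKernel)
      where
      collision : count π n ≡ 0 → ∃ (λ i → i < n × Tb i ≡ true) → ⊥
      collision none (i , i<n , bᵢ) = distinct (cong toℕ same)
        where
        aᵢ∈T : fromℕ< (a<N i<n) ∈ T
        aᵢ∈T = ind-∈ T (a<N i<n) (trans (mirrored none i i<n) bᵢ)
        bᵢ∈T : fromℕ< (b<N i<n) ∈ T
        bᵢ∈T = ind-∈ T (b<N i<n) bᵢ
        sameColour : colouring (fromℕ< (a<N i<n)) ≡ colouring (fromℕ< (b<N i<n))
        sameColour = trans (cong colour (toℕ-fromℕ< (a<N i<n)))
                     (trans (colour-low i<n)
                     (sym (trans (cong colour (toℕ-fromℕ< (b<N i<n))) (colour-high i<n))))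
        same : fromℕ< (a<N i<n) ≡ fromℕ< (b<N i<n)
        same = rainbow _ _ aᵢ∈T bᵢ∈T sameColour
        distinct : toℕ (fromℕ< (a<N i<n)) ≢ toℕ (fromℕ< (b<N i<n))
        distinct eq = m≢1+n+m i (trans (sym (toℕ-fromℕ< (a<N i<n))) (trans eq (toℕ-fromℕ< (b<N i<n))))

  -- Circuits contain a nonempty zero-sum set, hence have at least four elements.
  simple : Simple M
  simple C ((T , T⊆C , neT , sums) , _) =
    (λ ∣C∣≡1 → <⇒≱ (s≤s (s≤s z≤n)) (subst (4 ≤_) ∣C∣≡1 4≤∣C∣)) ,
    (λ ∣C∣≡2 → <⇒≱ (s≤s (s≤s (s≤s z≤n))) (subst (4 ≤_) ∣C∣≡2 4≤∣C∣))
    where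
    4≤∣C∣ : 4 ≤ ∣ C ∣
    4≤∣C∣ = ≤-trans (ZeroSumSet.size≥4 T sums neT) (p⊆q⇒∣p∣≤∣q∣ T⊆C)

  rainbowCircuits : ∀ C → Circuit M C → Rainbow colouring C → n < 2 * ∣ C ∣
  rainbowCircuits C ((T , T⊆C , neT , sums) , _) rainbow =
    ≤-trans (m<n+m n {2} z<s) (≤-trans (≤-reflexive (sym (double-shift k))) (*-monoʳ-≤ 2 large))
    where
    large : 2 + k ≤ ∣ C ∣
    large = ≤-trans (ZeroSumSet.rainbowSize T sums neT (λ e f e∈T f∈T → rainbow e f (T⊆C e∈T) (T⊆C f∈T)))
                    (p⊆q⇒∣p∣≤∣q∣ T⊆C)

  -- Colour class of c is {a_c, b_c}.
  classes : ClassesOfSizeTwo colouring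
  classes e = begin
    ∣ colourClass colouring e ∣
      ≡⟨ ∣p∣≡count (colourClass colouring e) ⟩
    count (ind (colourClass colouring e)) N
      ≡⟨ count-cong N (λ j j<N → ind-tabulate (λ j → colour j ≡ᵇ c) j<N) ⟩
    count (λ j → colour j ≡ᵇ c) N
      ≡⟨ count-double (λ j → colour j ≡ᵇ c) n ⟩
    count (λ j → colour j ≡ᵇ c) n + count (λ j → colour (n + j) ≡ᵇ c) n
      ≡⟨ cong₂ _+_ (count-cong n (λ j j<n → cong (_≡ᵇ c) (colour-low j<n)))
                   (count-cong n (λ j j<n → cong (_≡ᵇ c) (colour-high j<n))) ⟩
    count (λ j → j ≡ᵇ c) n + count (λ j → j ≡ᵇ c) n
      ≡⟨ cong₂ _+_ (count-point n c<n) (count-point n c<n) ⟩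
    2 ∎
    where
    c : ℕ
    c = colouring e
    c<n : c < n
    c<n = m%n<n (toℕ e) n

  -- A basis: the columns a₁, a₃, a₄, …, a_{n-1} and b₀, i.e. the indices 1 and
  -- 3, …, n.  It omits a₀ and a₂, which pin the kernel vector to zero.
  inBasis : ℕ → Bool
  inBasis j = (j ≡ᵇ 1) ∨ ((3 ≤ᵇ j) ∧ (j ≤ᵇ n))

  basis : Subset N
  basis = tabulate (λ e → inBasis (toℕ e))

  -- n = 3 + L, so the a-part of the basis is a₁ followed by the run a₃ … a_{n-1}.
  L : ℕ
  L = suc (t + k)

  laterB-outside : ∀ j → inBasis (n + suc j) ≡ false
  laterB-outside j = ≤ᵇ-false (m+1+n≰m n)

  basis-size : ∣ basis ∣ ≡ m
  basis-size = begin
    ∣ basis ∣                                                  ≡⟨ ∣p∣≡count basis ⟩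
    count (ind basis) N                                        ≡⟨ count-cong N (λ j j<N → ind-tabulate inBasis j<N) ⟩
    count inBasis N                                            ≡⟨ count-double inBasis n ⟩
    count inBasis n + count (λ j → inBasis (n + j)) n          ≡⟨ cong₂ _+_ aPart bPart ⟩
    (1 + L) + 1                                                ≡⟨ +-comm (1 + L) 1 ⟩
    m                                                          ∎
    where
    aPart : count inBasis n ≡ 1 + L
    aPart = trans (count-split inBasis 3 L)
                  (cong (1 +_) (count-const true L (λ j j<L → ≤ᵇ-true (s≤s (s≤s (s≤s (<⇒≤ j<L)))))))
    bPart : count (λ j → inBasis (n + j)) n ≡ 1
    bPart = cong₂ (λ x c → weight x 1 + c) (≤ᵇ-true (≤-reflexive (+-identityʳ n)))
                  (count-const false (suc (suc L)) (λ j _ → laterB-outside j))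

  -- A zero-sum subset of the basis has no b's and π 0 = π 2 = 0, hence is empty.
  basis-independent : ∀ T → T ⊆ basis → Nonempty T → ¬ ZeroSum M T
  basis-independent T T⊆basis neT sums = <⇒≢ (size-of-nonempty neT) (sym empty)
    where
    open ZeroSumSet T sums
    outside : ∀ j → j < N → inBasis j ≡ false → ind T j ≡ false
    outside j j<N off = ¬-not (λ inT → contradiction
      (trans (sym (ind-mono T⊆basis j inT)) (trans (ind-tabulate inBasis j<N) off)) λ ())
    laterB : ∀ j → suc j < n → Tb (suc j) ≡ false
    laterB j 1+j<n = outside (n + suc j) (b<N 1+j<n) (laterB-outside j)
    -- b₀ is in the basis, but T has an even number of b's.
    noB : ∀ j → j < n → Tb j ≡ false
    noB zero    _     = begin
      Tb 0                                      ≡⟨ xor-identityʳ (Tb 0) ⟨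
      Tb 0 xor false                            ≡⟨ cong (Tb 0 xor_) (parity-vanish (suc (suc L)) (λ j j<2+L → laterB j (s≤s j<2+L))) ⟨
      Tb 0 xor parity (Tb ∘ suc) (suc (suc L))  ≡⟨ evenB ⟩
      false                                     ∎
    noB (suc j) 1+j<n = laterB j 1+j<n
    π₀ : π 0 ≡ false
    π₀ = cong₂ _xor_ (outside 0 z<s refl) (noB 0 z<s)
    π₂ : π 2 ≡ false
    π₂ = cong₂ _xor_ (outside 2 (s≤s (s≤s (s≤s z≤n))) refl) (noB 2 (s≤s (s≤s (s≤s z≤n))))
    empty : ∣ T ∣ ≡ 0
    empty = trans (mirroredSize (kernelPinned inKernel π₀ π₂))
                  (cong₂ _+_ (count-const false n noB) (count-const false n noB))

  rank : HasRank M m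
  rank = (basis , independent⇒circuitFree M basis basis-independent , basis-size) , circuitFree-size M

  witness : Witness n
  witness = m , M , colouring , simple , rank , classes , rainbowCircuits

-- The even numbers n ≥ 6 are exactly the values 2 + 2k, k = 2 + t.
size-of-even : ∀ t → 2 + ((2 + t) + (2 + t)) ≡ (3 + t) * 2
size-of-even = solve-∀

theorem4p3 : ∀ (n : ℕ) → 6 ≤ n → 2 ∣ n →
    ∃ λ (m : ℕ) → Σ (Matrix₂ m (2 * n)) λ A → Σ (Fin (2 * n) → ℕ) λ c →
      Simple A × HasRank A (n ∸ 1) × ClassesOfSizeTwo c ×
      (∀ C → Circuit A C → Rainbow c C → n < 2 * ∣ C ∣)
theorem4p3 _ () (divides 0 refl)
theorem4p3 _ (s≤s (s≤s ())) (divides 1 refl)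
theorem4p3 _ (s≤s (s≤s (s≤s (s≤s ())))) (divides 2 refl)
theorem4p3 _ _ (divides (suc (suc (suc t))) refl) =
  subst Witness (size-of-even t) (Construction.witness t)
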